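{- For every integer $n\ge 3$ and every odd integer $q\ge 3$, there exists an automata network $F:Q^n\to Q^n$ with $Q=\{0,\dots,q-1\}$, of degree at most $\lceil 2n/3\rceil$, whose rank is $q^n-2$.
   Context: An automata network is a map $F:Q^V\to Q^V$, $V=\{1,\dots,n\}$, with local functions $f_j(x)=F(x)_j$. Its interaction graph has an arc $(i,j)$ iff $f_j$ effectively depends on $x_i$ (there exist $x,x'$ differing only at $i$ with $f_j(x)\neq f_j(x')$). The degree of $F$ is the maximum in-degree of its interaction graph. The rank of $F$ is $|F(Q^V)|$. -}

module Defs where

open import Data.Nat using (ℕ; _≤_)
open import Data.Fin using (Fin)
open import Data.Fin.Subset using (Subset; _∈_; ∣_∣)
open import Data.Vec using (Vec; lookup; _[_]≔_)
open import Data.List using (List; length)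
open import Data.List.Relation.Unary.Unique.Propositional using (Unique)
import Data.List.Membership.Propositional as LM
open import Data.Product using (Σ; ∃; _×_)
open import Relation.Binary.PropositionalEquality using (_≡_; _≢_)
open import Function.Bundles using (_⇔_)

Config : ℕ → ℕ → Set
Config n q = Vec (Fin q) n

AutomataNetwork : ℕ → ℕ → Set
AutomataNetwork n q = Config n q → Config n q

local : ∀ {n q} → AutomataNetwork n q → Fin n → Config n q → Fin q
local F j x = lookup (F x) j

-- arc (i , j) in the interaction graph: f_j effectively depends on x_i,
-- i.e. there are x, x' differing only at i with f_j(x) ≠ f_j(x')
Arc : ∀ {n q} → AutomataNetwork n q → Fin n → Fin n → Set
Arc F i j = ∃ λ x → ∃ λ a → local F j x ≢ local F j (x [ i ]≔ a)

DegreeAtMost : ∀ {n q} → AutomataNetwork n q → ℕ → Set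
DegreeAtMost {n} F d =
  (j : Fin n) → Σ (Subset n) λ S → (∣ S ∣ ≤ d) × (∀ i → Arc F i j → i ∈ S)

RankIs : ∀ {n q} → AutomataNetwork n q → ℕ → Set
RankIs {n} {q} F r =
  Σ (List (Config n q)) λ L →
    Unique L × (∀ y → (y LM.∈ L) ⇔ (∃ λ x → F x ≡ y)) × (length L ≡ r)

-- Write a configuration as x₀ ∷ x₁ ∷ x₂ ∷ r with r ∈ Qᵐ, and split the positions of r alternately
-- into A and B. The network keeps r and maps x₁ to x₁ + x₂, x₀ to twist₀(x₀) + x₁ and x₂ to twist₂(x₂),
-- where twist₀ is switched on only if r vanishes on A and twist₂ only if r vanishes on B; so every local
-- function reads at most 2 + ⌈m/2⌉ ≤ ⌈2n/3⌉ variables.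
-- Given y, solving for x₂ = y₂, then x₁, then x₀ yields a preimage unless twist₂ is on and the solution
-- lies on the line x₀ = x₂ = 0 or on the line x₀ = x₂ = 2. Such y have the form (τ t, t, 0) or (s, s, 2),
-- while with twist₂ on the two lines are mapped onto (s, s, 0) and (τ t, t, 2), where τ t = t except that
-- τ 0 = 1 when twist₀ is on as well. Hence exactly (1, 0, 0) and (0, 0, 2), padded with r = 0, are lost.
module Submission where

open import Defs
open import Data.Nat using (ℕ; _≤_; _+_; _*_; _∸_; _^_; _/_; _%_)
open import Data.Product using (Σ; _×_)
open import Relation.Binary.PropositionalEquality using (_≡_)

open import Data.Nat using (zero; suc; z≤n; s≤s)
open import Data.Nat.Properties
  using (+-comm; +-assoc; m∸n+n≡m; ≤-refl; ≤-trans; ≤-reflexive; +-monoʳ-≤; +-mono-≤; m≤n*m; *-suc; n≤1+n;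
         module ≤-Reasoning)
open import Data.Nat.DivMod using (m%n<n; m%n%n≡m%n; %-distribˡ-+; [m+n]%n≡m%n; m<n⇒m%n≡m; m*n/n≡m; /-monoˡ-≤)
open import Data.Nat.Tactic.RingSolver using (solve-∀)
open import Data.Bool using (Bool; true; false; not)
open import Data.Fin using (Fin; zero; suc; toℕ; fromℕ<; _≟_)
open import Data.Fin.Patterns using (0F; 1F; 2F)
open import Data.Fin.Properties using (toℕ-fromℕ<; toℕ-injective; toℕ<n; toℕ≤n)
open import Data.Fin.Subset using (Subset; inside; outside; ⊥; ⁅_⁆; ∣_∣) renaming (_∈_ to _∈ₛ_)
open import Data.Fin.Subset.Properties using (∣⊥∣≡0; ∣⁅x⁆∣≡1; x∈⁅x⁆)
open import Data.Vec using (Vec; []; _∷_; _++_; replicate; _[_]≔_; here; there)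
open import Data.Vec.Properties using (∷-injective; ∷-injectiveˡ; ++-injective; lookup∘update′; ≡-dec)
open import Data.List using (List; []; _∷_; length; map; filter; cartesianProductWith; allFin)
open import Data.List.Properties using (length-map; length-++; length-tabulate; filter-all)
import Data.List.Relation.Unary.All as All
open import Data.List.Relation.Unary.Any using (here; there)
open import Data.List.Relation.Unary.AllPairs using ([]; _∷_)
open import Data.List.Relation.Unary.Unique.Propositional using (Unique)
import Data.List.Relation.Unary.Unique.Propositional.Properties as Unique
open import Data.List.Membership.Propositional using (_∈_)
open import Data.List.Membership.Propositional.Properties
  using (∈-allFin; ∈-cartesianProductWith⁺; ∈-filter⁺; ∈-filter⁻)
open import Data.Product using (∃; _,_; -,_; proj₁; proj₂)
open import Data.Sum using (_⊎_; inj₁; inj₂)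
open import Data.Empty using (⊥-elim)
open import Function using (id; _∘_)
open import Function.Bundles using (_⇔_; mk⇔; Equivalence)
open import Relation.Nullary using (Dec; yes; no; ¬?)
open import Relation.Binary.Definitions using (DecidableEquality)
open import Relation.Binary.PropositionalEquality
  using (_≢_; refl; sym; trans; cong; cong₂; subst; subst₂; module ≡-Reasoning)

module ModularArithmetic (p : ℕ) where

  private
    q : ℕ
    q = suc p

    ⟦_⟧ : ℕ → Fin q
    ⟦ m ⟧ = fromℕ< (m%n<n m q)

    ⟦⟧-cong : ∀ m n → m % q ≡ n % q → ⟦ m ⟧ ≡ ⟦ n ⟧
    ⟦⟧-cong m n eq = toℕ-injective (begin
      toℕ ⟦ m ⟧ ≡⟨ toℕ-fromℕ< (m%n<n m q) ⟩
      m % q     ≡⟨ eq ⟩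
      n % q     ≡⟨ toℕ-fromℕ< (m%n<n n q) ⟨
      toℕ ⟦ n ⟧ ∎)
      where open ≡-Reasoning

    ⟦toℕ⟧ : ∀ i → ⟦ toℕ i ⟧ ≡ i
    ⟦toℕ⟧ i = toℕ-injective (trans (toℕ-fromℕ< (m%n<n (toℕ i) q)) (m<n⇒m%n≡m (toℕ<n i)))

    ⟦toℕ⟦⟧+⟧ : ∀ m n → ⟦ toℕ ⟦ m ⟧ + n ⟧ ≡ ⟦ m + n ⟧
    ⟦toℕ⟦⟧+⟧ m n = ⟦⟧-cong (toℕ ⟦ m ⟧ + n) (m + n) (begin
      (toℕ ⟦ m ⟧ + n) % q     ≡⟨ cong (λ t → (t + n) % q) (toℕ-fromℕ< (m%n<n m q)) ⟩
      (m % q + n) % q         ≡⟨ %-distribˡ-+ (m % q) n q ⟩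
      (m % q % q + n % q) % q ≡⟨ cong (λ t → (t + n % q) % q) (m%n%n≡m%n m q) ⟩
      (m % q + n % q) % q     ≡⟨ %-distribˡ-+ m n q ⟨
      (m + n) % q             ∎)
      where open ≡-Reasoning

    ⟦toℕ+q⟧ : ∀ i → ⟦ toℕ i + q ⟧ ≡ i
    ⟦toℕ+q⟧ i = trans (⟦⟧-cong (toℕ i + q) (toℕ i) ([m+n]%n≡m%n (toℕ i) q)) (⟦toℕ⟧ i)

  infixl 6 _⊕_ _⊖_

  _⊕_ : Fin q → Fin q → Fin q
  i ⊕ j = ⟦ toℕ i + toℕ j ⟧

  _⊖_ : Fin q → Fin q → Fin q
  i ⊖ j = ⟦ toℕ i + (q ∸ toℕ j) ⟧

  ⊕-comm : ∀ i j → i ⊕ j ≡ j ⊕ i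
  ⊕-comm i j = cong ⟦_⟧ (+-comm (toℕ i) (toℕ j))

  ⊕-identityʳ : ∀ i → i ⊕ 0F ≡ i
  ⊕-identityʳ i = trans (⊕-comm i 0F) (⟦toℕ⟧ i)

  ⊖-⊕-cancel : ∀ i j → i ⊖ j ⊕ j ≡ i
  ⊖-⊕-cancel i j = begin
    ⟦ toℕ ⟦ toℕ i + (q ∸ toℕ j) ⟧ + toℕ j ⟧ ≡⟨ ⟦toℕ⟦⟧+⟧ (toℕ i + (q ∸ toℕ j)) (toℕ j) ⟩
    ⟦ toℕ i + (q ∸ toℕ j) + toℕ j ⟧         ≡⟨ cong ⟦_⟧ (+-assoc (toℕ i) (q ∸ toℕ j) (toℕ j)) ⟩
    ⟦ toℕ i + (q ∸ toℕ j + toℕ j) ⟧         ≡⟨ cong (λ t → ⟦ toℕ i + t ⟧) (m∸n+n≡m (toℕ≤n j)) ⟩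
    ⟦ toℕ i + q ⟧                           ≡⟨ ⟦toℕ+q⟧ i ⟩
    i                                       ∎
    where open ≡-Reasoning

  ⊕-⊖-cancel : ∀ i j → i ⊕ j ⊖ j ≡ i
  ⊕-⊖-cancel i j = begin
    ⟦ toℕ ⟦ toℕ i + toℕ j ⟧ + (q ∸ toℕ j) ⟧ ≡⟨ ⟦toℕ⟦⟧+⟧ (toℕ i + toℕ j) (q ∸ toℕ j) ⟩
    ⟦ toℕ i + toℕ j + (q ∸ toℕ j) ⟧         ≡⟨ cong ⟦_⟧ (+-assoc (toℕ i) (toℕ j) (q ∸ toℕ j)) ⟩
    ⟦ toℕ i + (toℕ j + (q ∸ toℕ j)) ⟧       ≡⟨ cong (λ t → ⟦ toℕ i + t ⟧) (+-comm (toℕ j) (q ∸ toℕ j)) ⟩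
    ⟦ toℕ i + (q ∸ toℕ j + toℕ j) ⟧         ≡⟨ cong (λ t → ⟦ toℕ i + t ⟧) (m∸n+n≡m (toℕ≤n j)) ⟩
    ⟦ toℕ i + q ⟧                           ≡⟨ ⟦toℕ+q⟧ i ⟩
    i                                       ∎
    where open ≡-Reasoning

  ⊕-cancelʳ : ∀ {i j} k → i ⊕ k ≡ j ⊕ k → i ≡ j
  ⊕-cancelʳ {i} {j} k eq = begin
    i         ≡⟨ ⊕-⊖-cancel i k ⟨
    i ⊕ k ⊖ k ≡⟨ cong (_⊖ k) eq ⟩
    j ⊕ k ⊖ k ≡⟨ ⊕-⊖-cancel j k ⟩
    j         ∎
    where open ≡-Reasoning

length-cartesianProductWith : ∀ {A B C : Set} (f : A → B → C) xs ys →
                              length (cartesianProductWith f xs ys) ≡ length xs * length ys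
length-cartesianProductWith f []       ys = refl
length-cartesianProductWith f (x ∷ xs) ys =
  trans (length-++ (map (f x) ys)) (cong₂ _+_ (length-map (f x) ys) (length-cartesianProductWith f xs ys))

configurations : ∀ n q → List (Config n q)
configurations zero    q = [] ∷ []
configurations (suc n) q = cartesianProductWith _∷_ (allFin q) (configurations n q)

∈-configurations : ∀ {n q} (x : Config n q) → x ∈ configurations n q
∈-configurations []      = here refl
∈-configurations (i ∷ x) = ∈-cartesianProductWith⁺ _∷_ (∈-allFin i) (∈-configurations x)

configurations-unique : ∀ n q → Unique (configurations n q)
configurations-unique zero    q = All.[] ∷ []
configurations-unique (suc n) q =
  Unique.cartesianProductWith⁺ _∷_ ∷-injective (Unique.allFin⁺ q) (configurations-unique n q)

length-configurations : ∀ n q → length (configurations n q) ≡ q ^ n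
length-configurations zero    q = refl
length-configurations (suc n) q = trans
  (length-cartesianProductWith _∷_ (allFin q) (configurations n q))
  (cong₂ _*_ (length-tabulate {n = q} id) (length-configurations n q))

module _ {A : Set} (_≟ₐ_ : DecidableEquality A) where

  length-filter-≢ : ∀ {z} {xs : List A} → Unique xs → z ∈ xs →
                    suc (length (filter (λ x → ¬? (x ≟ₐ z)) xs)) ≡ length xs
  length-filter-≢ {z} {x ∷ xs} (x∉xs ∷ xs!) z∈x∷xs with x ≟ₐ z | z∈x∷xs
  ... | yes refl | _           =
    cong (suc ∘ length) (filter-all (λ y → ¬? (y ≟ₐ x)) (All.map (λ x≢y y≡x → x≢y (sym y≡x)) x∉xs))
  ... | no x≢z   | here z≡x    = ⊥-elim (x≢z (sym z≡x))
  ... | no _     | there z∈xs = cong suc (length-filter-≢ xs! z∈xs)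

rankIs-all-but-two : ∀ {n q} (F : AutomataNetwork n q) {u v : Config n q} → u ≢ v →
                     (∀ y → (∃ λ x → F x ≡ y) ⇔ (y ≢ u × y ≢ v)) → RankIs F (q ^ n ∸ 2)
rankIs-all-but-two {n} {q} F {u} {v} u≢v image = without u (without v all) , unique , members , len
  where
  all : List (Config n q)
  all = configurations n q

  _≟ᶜ_ : DecidableEquality (Config n q)
  _≟ᶜ_ = ≡-dec _≟_

  differs : ∀ z x → Dec (x ≢ z)
  differs z x = ¬? (x ≟ᶜ z)

  without : Config n q → List (Config n q) → List (Config n q)
  without z = filter (differs z)

  unique-without-v : Unique (without v all)
  unique-without-v = Unique.filter⁺ _ (configurations-unique n q)

  unique : Unique (without u (without v all))
  unique = Unique.filter⁺ _ unique-without-v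

  members : ∀ y → y ∈ without u (without v all) ⇔ (∃ λ x → F x ≡ y)
  members y = mk⇔
    (λ y∈ → let y∈′ , y≢u = ∈-filter⁻ (differs u) {xs = without v all} y∈
            in Equivalence.from (image y) (y≢u , proj₂ (∈-filter⁻ (differs v) {xs = all} y∈′)))
    (λ hit → let y≢u , y≢v = Equivalence.to (image y) hit
             in ∈-filter⁺ (differs u) (∈-filter⁺ (differs v) (∈-configurations y) y≢v) y≢u)

  len : length (without u (without v all)) ≡ q ^ n ∸ 2
  len = cong (_∸ 2) (begin
    suc (suc (length (without u (without v all))))
      ≡⟨ cong suc (length-filter-≢ _≟ᶜ_ unique-without-v (∈-filter⁺ (differs v) (∈-configurations u) u≢v)) ⟩
    suc (length (without v all))
      ≡⟨ length-filter-≢ _≟ᶜ_ (configurations-unique n q) (∈-configurations v) ⟩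
    length all
      ≡⟨ length-configurations n q ⟩
    q ^ n
      ∎)
    where open ≡-Reasoning

alternating : Bool → (m : ℕ) → Subset m
alternating _     zero    = []
alternating true  (suc m) = inside ∷ alternating false m
alternating false (suc m) = outside ∷ alternating true m

2*∣alternating∣≤1+m : ∀ b m → 2 * ∣ alternating b m ∣ ≤ suc m
2*∣alternating∣≤1+m _     zero          = z≤n
2*∣alternating∣≤1+m true  (suc zero)    = ≤-refl
2*∣alternating∣≤1+m false (suc zero)    = z≤n
2*∣alternating∣≤1+m true  (suc (suc m)) =
  ≤-trans (≤-reflexive (*-suc 2 _)) (s≤s (s≤s (2*∣alternating∣≤1+m true m)))
2*∣alternating∣≤1+m false (suc (suc m)) =
  ≤-trans (≤-reflexive (*-suc 2 _)) (s≤s (s≤s (2*∣alternating∣≤1+m false m)))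

2+c≤⌈2[3+m]/3⌉ : ∀ m {c} → 2 * c ≤ suc m → 2 + c ≤ (2 * (3 + m) + 2) / 3
2+c≤⌈2[3+m]/3⌉ m {c} 2c≤1+m = begin
  2 + c                       ≡⟨ m*n/n≡m (2 + c) 3 ⟨
  (2 + c) * 3 / 3             ≤⟨ /-monoˡ-≤ 3 (begin
    (2 + c) * 3                 ≡⟨ left c ⟩
    6 + (c + 2 * c)             ≤⟨ +-monoʳ-≤ 6 (+-mono-≤ (≤-trans (m≤n*m c 2) 2c≤1+m) 2c≤1+m) ⟩
    6 + (suc m + suc m)         ≡⟨ right m ⟩
    2 * (3 + m) + 2             ∎) ⟩
  (2 * (3 + m) + 2) / 3       ∎
  where
  open ≤-Reasoning
  left : ∀ c → (2 + c) * 3 ≡ 6 + (c + 2 * c)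
  left = solve-∀
  right : ∀ m → 6 + (suc m + suc m) ≡ 2 * (3 + m) + 2
  right = solve-∀

vanishesOn : ∀ {p m} → Subset m → Vec (Fin (suc p)) m → Bool
vanishesOn []           []          = true
vanishesOn (inside ∷ S) (suc _ ∷ r) = false
vanishesOn (_ ∷ S)      (_ ∷ r)     = vanishesOn S r

vanishesOn-replicate : ∀ {p m} (S : Subset m) → vanishesOn S (replicate m (zero {p})) ≡ true
vanishesOn-replicate []            = refl
vanishesOn-replicate (inside ∷ S)  = vanishesOn-replicate S
vanishesOn-replicate (outside ∷ S) = vanishesOn-replicate S

vanishesOn-alternating : ∀ {p m} b (r : Vec (Fin (suc p)) m) →
                         vanishesOn (alternating b m) r ≡ true → vanishesOn (alternating (not b) m) r ≡ true →
                         r ≡ replicate m 0F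
vanishesOn-alternating b     []           _  _  = refl
vanishesOn-alternating true  (0F ∷ r)     e₁ e₂ = cong (0F ∷_) (vanishesOn-alternating false r e₁ e₂)
vanishesOn-alternating false (0F ∷ r)     e₁ e₂ = cong (0F ∷_) (vanishesOn-alternating true r e₁ e₂)
vanishesOn-alternating true  (suc _ ∷ r) () _
vanishesOn-alternating false (suc _ ∷ r) _ ()

vanishesOn-[]≔ : ∀ {p m} (S : Subset m) (r : Vec (Fin (suc p)) m) i a →
                 vanishesOn S r ≢ vanishesOn S (r [ i ]≔ a) → i ∈ₛ S
vanishesOn-[]≔ (inside ∷ S)  (x ∷ r)      zero    a _ = here
vanishesOn-[]≔ (outside ∷ S) (x ∷ r)      zero    a ≢ = ⊥-elim (≢ refl)
vanishesOn-[]≔ (inside ∷ S)  (0F ∷ r)     (suc i) a ≢ = there (vanishesOn-[]≔ S r i a ≢)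
vanishesOn-[]≔ (inside ∷ S)  (suc _ ∷ r)  (suc i) a ≢ = ⊥-elim (≢ refl)
vanishesOn-[]≔ (outside ∷ S) (x ∷ r)      (suc i) a ≢ = there (vanishesOn-[]≔ S r i a ≢)

module Core (k : ℕ) where
  open ModularArithmetic (2 + k)

  Q : Set
  Q = Fin (3 + k)

  twist₀ : Bool → Q → Q → Q
  twist₀ true 0F 0F = 1F
  twist₀ true 1F 0F = 0F
  twist₀ _    x₀ _  = x₀

  twist₂ : Bool → Q → Q → Q
  twist₂ true 0F 0F = 2F
  twist₂ true 2F 2F = 0F
  twist₂ _    x₂ _  = x₂

  core : Bool → Bool → Vec Q 3 → Vec Q 3
  core a b (x₀ ∷ x₁ ∷ x₂ ∷ []) = twist₀ a x₀ x₁ ⊕ x₁ ∷ x₁ ⊕ x₂ ∷ twist₂ b x₂ x₀ ∷ []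

  hole₁ hole₂ : Vec Q 3
  hole₁ = 1F ∷ 0F ∷ 0F ∷ []
  hole₂ = 0F ∷ 0F ∷ 2F ∷ []

  twist₀-involutive : ∀ a x₀ x₁ → twist₀ a (twist₀ a x₀ x₁) x₁ ≡ x₀
  twist₀-involutive true 0F 0F = refl
  twist₀-involutive true 1F 0F = refl
  twist₀-involutive true 0F (suc _) = refl
  twist₀-involutive true 1F (suc _) = refl
  twist₀-involutive true (suc (suc _)) _ = refl
  twist₀-involutive false _ _ = refl

  twist₀-2F : ∀ a x₁ → twist₀ a 2F x₁ ≡ 2F
  twist₀-2F true  _ = refl
  twist₀-2F false _ = refl

  twist₀≡2F : ∀ a x₀ x₁ → twist₀ a x₀ x₁ ≡ 2F → x₀ ≡ 2F
  twist₀≡2F a x₀ x₁ eq = begin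
    x₀                             ≡⟨ twist₀-involutive a x₀ x₁ ⟨
    twist₀ a (twist₀ a x₀ x₁) x₁   ≡⟨ cong (λ t → twist₀ a t x₁) eq ⟩
    twist₀ a 2F x₁                 ≡⟨ twist₀-2F a x₁ ⟩
    2F                             ∎
    where open ≡-Reasoning

  preimage₀ : Bool → Q → Q → Q
  preimage₀ a y₀ x₁ = twist₀ a (y₀ ⊖ x₁) x₁

  preimage₀-solves : ∀ a y₀ x₁ → twist₀ a (preimage₀ a y₀ x₁) x₁ ⊕ x₁ ≡ y₀
  preimage₀-solves a y₀ x₁ = trans (cong (_⊕ x₁) (twist₀-involutive a (y₀ ⊖ x₁) x₁)) (⊖-⊕-cancel y₀ x₁)

  core-preimage : ∀ a b y₀ y₁ x₂ → let x₁ = y₁ ⊖ x₂ ; x₀ = preimage₀ a y₀ x₁ in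
                  core a b (x₀ ∷ x₁ ∷ x₂ ∷ []) ≡ y₀ ∷ y₁ ∷ twist₂ b x₂ x₀ ∷ []
  core-preimage a b y₀ y₁ x₂ = cong₂ (λ u v → u ∷ v ∷ twist₂ b x₂ (preimage₀ a y₀ x₁) ∷ [])
    (preimage₀-solves a y₀ x₁)
    (⊖-⊕-cancel y₁ x₂)
    where
    x₁ : Q
    x₁ = y₁ ⊖ x₂

  preimage-hits : ∀ {a b y₀ y₁ x₂ x₀} → preimage₀ a y₀ (y₁ ⊖ x₂) ≡ x₀ → twist₂ b x₂ x₀ ≡ x₂ →
                  ∃ λ x → core a b x ≡ y₀ ∷ y₁ ∷ x₂ ∷ []
  preimage-hits {a} {b} {y₀} {y₁} {x₂} refl fixed =
    -, trans (core-preimage a b y₀ y₁ x₂) (cong (λ t → y₀ ∷ y₁ ∷ t ∷ []) fixed)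

  τ : Bool → Q → Q
  τ a t = twist₀ a 0F t ⊕ t

  τ-cases : ∀ a t → τ a t ≡ t ⊕ 0F ⊎ (a ≡ true × t ≡ 0F)
  τ-cases false t       = inj₁ (⊕-comm 0F t)
  τ-cases true  (suc t) = inj₁ (⊕-comm 0F (suc t))
  τ-cases true  0F      = inj₂ (refl , refl)

  core-line₀ : ∀ a t → core a true (0F ∷ t ∷ 0F ∷ []) ≡ τ a t ∷ t ⊕ 0F ∷ 2F ∷ []
  core-line₀ a t = refl

  core-line₂ : ∀ a s → core a true (2F ∷ s ⊖ 2F ∷ 2F ∷ []) ≡ s ∷ s ∷ 0F ∷ []
  core-line₂ a s = cong₂ (λ u v → u ∷ v ∷ 0F ∷ [])
    (trans (cong (_⊕ (s ⊖ 2F)) (twist₀-2F a (s ⊖ 2F))) (trans (⊕-comm 2F (s ⊖ 2F)) (⊖-⊕-cancel s 2F)))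
    (⊖-⊕-cancel s 2F)

  preimage-on-line₀ : ∀ {a y₀ y₁} → preimage₀ a y₀ (y₁ ⊖ 0F) ≡ 0F → (a ≡ true → y₀ ∷ y₁ ∷ 0F ∷ [] ≢ hole₁) →
             ∃ λ x → core a true x ≡ y₀ ∷ y₁ ∷ 0F ∷ []
  preimage-on-line₀ {a} {y₀} {y₁} x₀≡0 ≢hole₁ = -, trans (core-line₂ a y₁) (cong (λ t → t ∷ y₁ ∷ 0F ∷ []) y₁≡y₀)
    where
    x₁ : Q
    x₁ = y₁ ⊖ 0F
    τ≡y₀ : τ a x₁ ≡ y₀
    τ≡y₀ = subst (λ x₀ → twist₀ a x₀ x₁ ⊕ x₁ ≡ y₀) x₀≡0 (preimage₀-solves a y₀ x₁)
    y₁≡ : x₁ ⊕ 0F ≡ y₁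
    y₁≡ = ⊖-⊕-cancel y₁ 0F
    y₁≡y₀ : y₁ ≡ y₀
    y₁≡y₀ with τ-cases a x₁
    ... | inj₁ e              = trans (sym y₁≡) (trans (sym e) τ≡y₀)
    ... | inj₂ (refl , x₁≡0) = ⊥-elim (≢hole₁ refl (cong₂ (λ u v → u ∷ v ∷ 0F ∷ [])
            (trans (sym τ≡y₀) (trans (cong (τ true) x₁≡0) (⊕-identityʳ 1F)))
            (trans (sym y₁≡) (trans (cong (_⊕ 0F) x₁≡0) (⊕-identityʳ 0F)))))

  preimage-on-line₂ : ∀ {a y₀ y₁} → preimage₀ a y₀ (y₁ ⊖ 2F) ≡ 2F → (a ≡ true → y₀ ∷ y₁ ∷ 2F ∷ [] ≢ hole₂) →
             ∃ λ x → core a true x ≡ y₀ ∷ y₁ ∷ 2F ∷ []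
  preimage-on-line₂ {a} {y₀} {y₁} x₀≡2 ≢hole₂ =
    -, trans (core-line₀ a y₁) (cong₂ (λ u v → u ∷ v ∷ 2F ∷ []) τ≡y₀ (⊕-identityʳ y₁))
    where
    x₁ : Q
    x₁ = y₁ ⊖ 2F
    y₀≡y₁ : y₀ ≡ y₁
    y₀≡y₁ = begin
      y₀                     ≡⟨ subst (λ x₀ → twist₀ a x₀ x₁ ⊕ x₁ ≡ y₀) x₀≡2 (preimage₀-solves a y₀ x₁) ⟨
      twist₀ a 2F x₁ ⊕ x₁    ≡⟨ cong (_⊕ x₁) (twist₀-2F a x₁) ⟩
      2F ⊕ x₁                ≡⟨ ⊕-comm 2F x₁ ⟩
      x₁ ⊕ 2F                ≡⟨ ⊖-⊕-cancel y₁ 2F ⟩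
      y₁                     ∎
      where open ≡-Reasoning
    τ≡y₀ : τ a y₁ ≡ y₀
    τ≡y₀ with τ-cases a y₁
    ... | inj₁ e              = trans e (trans (⊕-identityʳ y₁) (sym y₀≡y₁))
    ... | inj₂ (refl , y₁≡0) =
            ⊥-elim (≢hole₂ refl (cong₂ (λ u v → u ∷ v ∷ 2F ∷ []) (trans y₀≡y₁ y₁≡0) y₁≡0))

  core-surjective : ∀ a b y → (a ≡ true → b ≡ true → y ≢ hole₁ × y ≢ hole₂) → ∃ λ x → core a b x ≡ y
  core-surjective a false (y₀ ∷ y₁ ∷ y₂ ∷ []) _ = preimage-hits refl refl
  core-surjective a true (y₀ ∷ y₁ ∷ 1F ∷ []) _ = preimage-hits refl refl
  core-surjective a true (y₀ ∷ y₁ ∷ suc (suc (suc _)) ∷ []) _ = preimage-hits refl refl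
  core-surjective a true (y₀ ∷ y₁ ∷ 0F ∷ []) holes with preimage₀ a y₀ (y₁ ⊖ 0F) in x₀≡
  ... | 0F    = preimage-on-line₀ x₀≡ (λ a≡true → proj₁ (holes a≡true refl))
  ... | suc _ = preimage-hits x₀≡ refl
  core-surjective a true (y₀ ∷ y₁ ∷ 2F ∷ []) holes with preimage₀ a y₀ (y₁ ⊖ 2F) in x₀≡
  ... | 2F                = preimage-on-line₂ x₀≡ (λ a≡true → proj₂ (holes a≡true refl))
  ... | 0F                = preimage-hits x₀≡ refl
  ... | 1F                = preimage-hits x₀≡ refl
  ... | suc (suc (suc _)) = preimage-hits x₀≡ refl

  core-avoids-hole₁ : ∀ x → core true true x ≢ hole₁
  core-avoids-hole₁ (x₀ ∷ x₁ ∷ x₂ ∷ []) eq with ∷-injective eq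
  ... | e₀ , eq′ with ∷-injective eq′
  ... | e₁ , eq″ = avoids x₀ x₁ x₂ e₀ e₁ (∷-injectiveˡ eq″)
    where
    avoids : ∀ x₀ x₁ x₂ → twist₀ true x₀ x₁ ⊕ x₁ ≡ 1F → x₁ ⊕ x₂ ≡ 0F → twist₂ true x₂ x₀ ≢ 0F
    avoids 0F       x₁ 0F e₀ e₁ ()
    avoids (suc x₀) x₁ 0F e₀ e₁ e₂ with trans (sym (⊕-identityʳ x₁)) e₁
    avoids 1F .0F 0F e₀ e₁ e₂ | refl with trans (sym (⊕-identityʳ 0F)) e₀
    ... | ()
    avoids (suc (suc x₀)) .0F 0F e₀ e₁ e₂ | refl with trans (sym (⊕-identityʳ (suc (suc x₀)))) e₀
    ... | ()
    avoids 2F x₁ 2F e₀ e₁ e₂ with trans (sym e₀) (trans (⊕-comm 2F x₁) e₁)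
    ... | ()
    avoids 0F x₁ 2F _ _ ()
    avoids 1F x₁ 2F _ _ ()
    avoids (suc (suc (suc _))) x₁ 2F _ _ ()
    avoids x₀ x₁ 1F _ _ ()
    avoids x₀ x₁ (suc (suc (suc _))) _ _ ()

  core-avoids-hole₂ : ∀ x → core true true x ≢ hole₂
  core-avoids-hole₂ (x₀ ∷ x₁ ∷ x₂ ∷ []) eq with ∷-injective eq
  ... | e₀ , eq′ with ∷-injective eq′
  ... | e₁ , eq″ = avoids x₀ x₁ x₂ e₀ e₁ (∷-injectiveˡ eq″)
    where
    avoids : ∀ x₀ x₁ x₂ → twist₀ true x₀ x₁ ⊕ x₁ ≡ 0F → x₁ ⊕ x₂ ≡ 0F → twist₂ true x₂ x₀ ≢ 2F
    avoids 0F x₁ 0F e₀ e₁ e₂ with trans (sym (⊕-identityʳ x₁)) e₁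
    ... | refl with trans (sym (⊕-identityʳ 1F)) e₀
    ... | ()
    avoids x₀ x₁ 2F e₀ e₁ e₂
      with twist₀≡2F true x₀ x₁ (⊕-cancelʳ x₁ (trans e₀ (sym (trans (⊕-comm 2F x₁) e₁))))
    ... | refl with e₂
    ... | ()
    avoids (suc _) x₁ 0F _ _ ()
    avoids x₀ x₁ 1F _ _ ()
    avoids x₀ x₁ (suc (suc (suc _))) _ _ ()

module Network (k m : ℕ) where
  open ModularArithmetic (2 + k) using (_⊕_)
  open Core k

  A B : Subset m
  A = alternating true m
  B = alternating false m

  F : AutomataNetwork (3 + m) (3 + k)
  F (x₀ ∷ x₁ ∷ x₂ ∷ r) = core (vanishesOn A r) (vanishesOn B r) (x₀ ∷ x₁ ∷ x₂ ∷ []) ++ r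

  zeros : Vec Q m
  zeros = replicate m 0F

  F-avoids : ∀ {h} → (∀ x → core true true x ≢ h) → ∀ x → F x ≢ h ++ zeros
  F-avoids {h} avoids (x₀ ∷ x₁ ∷ x₂ ∷ r) eq
    with ++-injective (core (vanishesOn A r) (vanishesOn B r) (x₀ ∷ x₁ ∷ x₂ ∷ [])) h eq
  ... | hits , refl = avoids x
    (subst₂ (λ a b → core a b x ≡ h) (vanishesOn-replicate A) (vanishesOn-replicate B) hits)
    where
    x : Vec Q 3
    x = x₀ ∷ x₁ ∷ x₂ ∷ []

  F-onto : ∀ y → y ≢ hole₁ ++ zeros → y ≢ hole₂ ++ zeros → ∃ λ x → F x ≡ y
  F-onto (y₀ ∷ y₁ ∷ y₂ ∷ r) ≢hole₁ ≢hole₂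
    with core-surjective (vanishesOn A r) (vanishesOn B r) (y₀ ∷ y₁ ∷ y₂ ∷ []) holes
    where
    holes : vanishesOn A r ≡ true → vanishesOn B r ≡ true →
            y₀ ∷ y₁ ∷ y₂ ∷ [] ≢ hole₁ × y₀ ∷ y₁ ∷ y₂ ∷ [] ≢ hole₂
    holes onA onB = let r≡0 = vanishesOn-alternating true r onA onB in
      (λ eq → ≢hole₁ (cong₂ _++_ eq r≡0)) , (λ eq → ≢hole₂ (cong₂ _++_ eq r≡0))
  ... | x₀ ∷ x₁ ∷ x₂ ∷ [] , hits = x₀ ∷ x₁ ∷ x₂ ∷ r , cong (_++ r) hits

  F-image : ∀ y → (∃ λ x → F x ≡ y) ⇔ (y ≢ hole₁ ++ zeros × y ≢ hole₂ ++ zeros)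
  F-image y = mk⇔ (λ { (x , refl) → F-avoids core-avoids-hole₁ x , F-avoids core-avoids-hole₂ x })
                  (λ (≢hole₁ , ≢hole₂) → F-onto y ≢hole₁ ≢hole₂)

  holes-differ : hole₁ ++ zeros ≢ hole₂ ++ zeros
  holes-differ ()

  inNeighbours : Fin (3 + m) → Subset (3 + m)
  inNeighbours 0F                  = inside  ∷ inside  ∷ outside ∷ A
  inNeighbours 1F                  = outside ∷ inside  ∷ inside  ∷ ⊥
  inNeighbours 2F                  = inside  ∷ outside ∷ inside  ∷ B
  inNeighbours (suc (suc (suc j))) = outside ∷ outside ∷ outside ∷ ⁅ j ⁆

  arc⇒∈inNeighbours : ∀ i j → Arc F i j → i ∈ₛ inNeighbours j
  arc⇒∈inNeighbours 0F 0F _ = here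
  arc⇒∈inNeighbours 1F 0F _ = there here
  arc⇒∈inNeighbours 2F 0F (_ ∷ _ ∷ _ ∷ _ , _ , ≢) = ⊥-elim (≢ refl)
  arc⇒∈inNeighbours (suc (suc (suc i))) 0F (x₀ ∷ x₁ ∷ _ ∷ r , a , ≢) =
    there (there (there (vanishesOn-[]≔ A r i a (≢ ∘ cong (λ c → twist₀ c x₀ x₁ ⊕ x₁)))))
  arc⇒∈inNeighbours 0F 1F (_ ∷ _ ∷ _ ∷ _ , _ , ≢) = ⊥-elim (≢ refl)
  arc⇒∈inNeighbours 1F 1F _ = there here
  arc⇒∈inNeighbours 2F 1F _ = there (there here)
  arc⇒∈inNeighbours (suc (suc (suc _))) 1F (_ ∷ _ ∷ _ ∷ _ , _ , ≢) = ⊥-elim (≢ refl)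
  arc⇒∈inNeighbours 0F 2F _ = here
  arc⇒∈inNeighbours 1F 2F (_ ∷ _ ∷ _ ∷ _ , _ , ≢) = ⊥-elim (≢ refl)
  arc⇒∈inNeighbours 2F 2F _ = there (there here)
  arc⇒∈inNeighbours (suc (suc (suc i))) 2F (x₀ ∷ _ ∷ x₂ ∷ r , a , ≢) =
    there (there (there (vanishesOn-[]≔ B r i a (≢ ∘ cong (λ c → twist₂ c x₂ x₀)))))
  arc⇒∈inNeighbours 0F (suc (suc (suc _))) (_ ∷ _ ∷ _ ∷ _ , _ , ≢) = ⊥-elim (≢ refl)
  arc⇒∈inNeighbours 1F (suc (suc (suc _))) (_ ∷ _ ∷ _ ∷ _ , _ , ≢) = ⊥-elim (≢ refl)
  arc⇒∈inNeighbours 2F (suc (suc (suc _))) (_ ∷ _ ∷ _ ∷ _ , _ , ≢) = ⊥-elim (≢ refl)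
  arc⇒∈inNeighbours (suc (suc (suc i))) (suc (suc (suc j))) (_ ∷ _ ∷ _ ∷ r , a , ≢) with i ≟ j
  ... | yes refl = there (there (there (x∈⁅x⁆ i)))
  ... | no i≢j   = ⊥-elim (≢ (sym (lookup∘update′ (i≢j ∘ sym) r a)))

  d : ℕ
  d = (2 * (3 + m) + 2) / 3

  ∣inNeighbours∣≤ : ∀ j → ∣ inNeighbours j ∣ ≤ d
  ∣inNeighbours∣≤ 0F = 2+c≤⌈2[3+m]/3⌉ m (2*∣alternating∣≤1+m true m)
  ∣inNeighbours∣≤ 1F = subst (λ c → 2 + c ≤ d) (sym (∣⊥∣≡0 m)) (2+c≤⌈2[3+m]/3⌉ m z≤n)
  ∣inNeighbours∣≤ 2F = 2+c≤⌈2[3+m]/3⌉ m (2*∣alternating∣≤1+m false m)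
  ∣inNeighbours∣≤ (suc (suc (suc j))) =
    subst (_≤ d) (sym (∣⁅x⁆∣≡1 j)) (≤-trans (n≤1+n 1) (2+c≤⌈2[3+m]/3⌉ m z≤n))

  F-degree : DegreeAtMost F d
  F-degree j = inNeighbours j , ∣inNeighbours∣≤ j , λ i → arc⇒∈inNeighbours i j

theorem3 : (n q : ℕ) → 3 ≤ n → 3 ≤ q → q % 2 ≡ 1 →
    Σ (AutomataNetwork n q) λ F →
      DegreeAtMost F ((2 * n + 2) / 3) × RankIs F (q ^ n ∸ 2)
theorem3 (suc (suc (suc m))) (suc (suc (suc k))) (s≤s (s≤s (s≤s z≤n))) (s≤s (s≤s (s≤s z≤n))) _ =
  F , F-degree , rankIs-all-but-two F holes-differ F-image
  where open Network k m
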